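{- (1) Let $f(n)$ denote the number of ways to write $n\ge0$ as $\sum_{k\ge0}\epsilon_k2^k$ with all $\epsilon_k\in\{0,1,2\}$. Let $d\ge2$ be an integer. If the sequence $(f(n)\bmod d)_{n\ge0}$ is eventually periodic with period $T$, then $(d,T)=(2,3)$. (2) Let $b\ge3$ and $d\ge2$ be integers, and let $g(n)$ denote the number of ways to write $n\ge0$ as $\sum_{k\ge0}\epsilon_kb^k$ with all $\epsilon_k\in\{0,1\}$. Then the sequence $(g(n)\bmod d)_{n\ge0}$ is not eventually periodic.
   Context: Representations are counted as sequences $(\epsilon_k)_{k\ge0}$ with finitely many nonzero terms. A sequence $(u_n)$ is eventually periodic if there exist integers $N\ge0$, $T\ge1$ with $u_{n+T}=u_n$ for all $n\ge N$; its period is the smallest such $T$. -}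

module Defs where

open import Data.Nat using (ℕ; zero; suc; _+_; _*_; _≤_; _^_)
open import Data.Nat.Properties using (_≟_)
open import Data.List using (List; []; _∷_; [_]; map; concatMap; length; filter; upTo)
open import Data.Vec using (Vec; []; _∷_)
open import Data.Product using (_×_; ∃)
open import Relation.Binary.PropositionalEquality using (_≡_)

digitVecs : (D L : ℕ) → List (Vec ℕ L)
digitVecs D zero    = [ [] ]
digitVecs D (suc L) = concatMap (λ e → map (e ∷_) (digitVecs D L)) (upTo D)

value : {L : ℕ} → (b : ℕ) → Vec ℕ L → ℕ
value b []       = 0
value b (e ∷ es) = e + b * value b es

-- For b ≥ 2 any such representation has
-- εₖ = 0 whenever bᵏ > n, in particular for k ≥ n+1, so these are exactly
-- the digit vectors of length n+1 (trailing terms zero).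
numReps : (b D n : ℕ) → ℕ
numReps b D n = length (filter (λ v → value b v ≟ n) (digitVecs D (suc n)))

f : ℕ → ℕ
f n = numReps 2 3 n

g : ℕ → ℕ → ℕ
g b n = numReps b 2 n

EventuallyPeriodicWith : (ℕ → ℕ) → ℕ → Set
EventuallyPeriodicWith u T = 1 ≤ T × ∃ λ N → ∀ n → N ≤ n → u (n + T) ≡ u n

EventuallyPeriodic : (ℕ → ℕ) → Set
EventuallyPeriodic u = ∃ λ T → EventuallyPeriodicWith u T

HasPeriod : (ℕ → ℕ) → ℕ → Set
HasPeriod u T = EventuallyPeriodicWith u T × (∀ T′ → EventuallyPeriodicWith u T′ → T ≤ T′)

-- Splitting off the leading digit gives f(2m+1) = f(m), f(2m+2) = f(m+1) + f(m) and, for b ≥ 3,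
-- g(bm) = g(1+bm) = g(m), g(2+bm) = 0.  An even eventual period of f mod d can be halved, so there is
-- an odd one, 2h+1; the recurrences then give f(n) + f(n+h+2) ≡ 0, hence the period 3, and applying
-- this with h = 1 at n = 2^k - 1, where f(n) = 1, yields 2 ≡ 0 (mod d).  By minimality T ≤ 3; a period
-- 2 halves to a period 1, which would force f(n) ≡ 0 there.  For g, two powers b^i, b^j (i < j)
-- beyond the preperiod are congruent mod T, yet g(b^i + b^j) = 1 while g(b^j + b^j) = 0.
module Submission where

open import Defs
open import Data.Nat
open import Data.Nat.Properties
open import Data.Nat.DivMod
open import Data.Nat.Divisibility using (_∣?_; divides; ∣⇒≤; m%n≡0⇒n∣m)
open import Data.Nat.Induction using (<-wellFounded)
open import Data.Nat.ListAction using (sum)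
open import Data.Nat.Tactic.RingSolver using (solve-∀)
open import Data.Fin using (toℕ; fromℕ<)
open import Data.Fin.Properties using (pigeonhole; fromℕ<-injective)
open import Data.List using (List; []; _∷_; _++_; map; filter; length; concatMap; upTo; applyUpTo)
open import Data.List.Properties using (filter-++; length-++; filter-≐; filter-none; map-cong)
open import Data.List.Relation.Unary.All as All using (All; []; _∷_)
open import Data.List.Relation.Unary.All.Properties using (applyUpTo⁺₂; map⁺)
open import Data.Vec using (_∷_)
open import Data.Product using (_×_; ∃; ∃₂; _,_)
open import Data.Sum using (_⊎_; inj₁; inj₂)
open import Data.Empty using (⊥-elim)
open import Function using (_∘_)
open import Algebra.Properties.CommutativeSemigroup +-commutativeSemigroup
  using (x∙yz≈xz∙y; xy∙z≈xz∙y; xy∙z≈y∙zx)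
open import Induction.WellFounded using (Acc; acc)
open import Relation.Nullary using (¬_; yes; no)
open import Relation.Unary using (Pred; Decidable)
open import Relation.Binary.PropositionalEquality
  using (_≡_; _≢_; refl; sym; trans; cong; cong₂; subst; module ≡-Reasoning)

module _ {a b p} {A : Set a} {B : Set b} {P : Pred B p} (P? : Decidable P) where

  length-filter-map : (h : A → B) (xs : List A) →
                      length (filter P? (map h xs)) ≡ length (filter (P? ∘ h) xs)
  length-filter-map h [] = refl
  length-filter-map h (x ∷ xs) with P? (h x)
  ... | yes _ = cong suc (length-filter-map h xs)
  ... | no  _ = length-filter-map h xs

  length-filter-concatMap : (h : A → List B) (xs : List A) →
    length (filter P? (concatMap h xs)) ≡ sum (map (λ x → length (filter P? (h x))) xs)
  length-filter-concatMap h [] = refl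
  length-filter-concatMap h (x ∷ xs) = begin
    length (filter P? (h x ++ concatMap h xs))
      ≡⟨ cong length (filter-++ P? (h x) (concatMap h xs)) ⟩
    length (filter P? (h x) ++ filter P? (concatMap h xs))
      ≡⟨ length-++ (filter P? (h x)) ⟩
    length (filter P? (h x)) + length (filter P? (concatMap h xs))
      ≡⟨ cong (length (filter P? (h x)) +_) (length-filter-concatMap h xs) ⟩
    length (filter P? (h x)) + sum (map (λ x → length (filter P? (h x))) xs) ∎
    where open ≡-Reasoning

sum-zero : {xs : List ℕ} → All (_≡ 0) xs → sum xs ≡ 0
sum-zero []          = refl
sum-zero (refl ∷ zs) = sum-zero zs

module _ (d : ℕ) .{{_ : NonZero d}} where

  %-+-cong : ∀ {a a′ c c′} → a % d ≡ a′ % d → c % d ≡ c′ % d →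
             (a + c) % d ≡ (a′ + c′) % d
  %-+-cong {a} {a′} {c} {c′} a≡a′ c≡c′ = begin
    (a + c) % d               ≡⟨ %-distribˡ-+ a c d ⟩
    (a % d + c % d) % d       ≡⟨ cong₂ (λ x y → (x + y) % d) a≡a′ c≡c′ ⟩
    (a′ % d + c′ % d) % d     ≡⟨ %-distribˡ-+ a′ c′ d ⟨
    (a′ + c′) % d             ∎
    where open ≡-Reasoning

  [m+dk]%d≡m%d : ∀ m k → (m + d * k) % d ≡ m % d
  [m+dk]%d≡m%d m k = trans (cong (λ x → (m + x) % d) (*-comm d k)) ([m+kn]%n≡m%n m k d)

  digit-mismatch : ∀ e r → e % d ≢ r % d → ∀ m x → e + d * x ≢ r + d * m
  digit-mismatch e r e≢r m x eq =
    e≢r (trans (sym ([m+dk]%d≡m%d e x)) (trans (cong (_% d) eq) ([m+dk]%d≡m%d r m)))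

  distinct-digits : ∀ {e r} → e < d → r < d → e ≢ r → e % d ≢ r % d
  distinct-digits e<d r<d e≢r eq = e≢r (trans (sym (m<n⇒m%n≡m e<d)) (trans eq (m<n⇒m%n≡m r<d)))

%-+-cancelʳ : ∀ {a a′} c d .{{_ : NonZero d}} → (a + c) % d ≡ (a′ + c) % d → a % d ≡ a′ % d
%-+-cancelʳ {a} {a′} c d@(suc k) eq = begin
  a % d                   ≡⟨ [m+dk]%d≡m%d d a c ⟨
  (a + d * c) % d         ≡⟨ cong (_% d) (shift a c k) ⟩
  (a + c + c * k) % d     ≡⟨ %-+-cong d {a + c} {a′ + c} {c * k} eq refl ⟩
  (a′ + c + c * k) % d    ≡⟨ cong (_% d) (shift a′ c k) ⟨
  (a′ + d * c) % d        ≡⟨ [m+dk]%d≡m%d d a′ c ⟩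
  a′ % d                  ∎
  where
  open ≡-Reasoning
  shift : ∀ x c k → x + suc k * c ≡ x + c + c * k
  shift = solve-∀

1%d≢0%d : ∀ {d} .{{_ : NonZero d}} → 1 < d → 1 % d ≢ 0 % d
1%d≢0%d 1<d = distinct-digits _ 1<d (<-trans z<s 1<d) λ ()

PeriodicFrom : (ℕ → ℕ) → ℕ → ℕ → Set
PeriodicFrom u N T = ∀ n → N ≤ n → u (n + T) ≡ u n

module _ {u : ℕ → ℕ} {N T : ℕ} (per : PeriodicFrom u N T) where

  periodic-+* : ∀ q {n} → N ≤ n → u (n + q * T) ≡ u n
  periodic-+* zero    {n} _   = cong u (+-identityʳ n)
  periodic-+* (suc q) {n} N≤n = begin
    u (n + (T + q * T)) ≡⟨ cong u (x∙yz≈xz∙y n T (q * T)) ⟩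
    u (n + q * T + T)   ≡⟨ per (n + q * T) (≤-trans N≤n (m≤m+n n _)) ⟩
    u (n + q * T)       ≡⟨ periodic-+* q N≤n ⟩
    u n                 ∎
    where open ≡-Reasoning

  periodic-%-cong : .{{_ : NonZero T}} → ∀ {x y} → N ≤ x → N ≤ y → x % T ≡ y % T → u x ≡ u y
  periodic-%-cong {x} {y} N≤x N≤y x≡y =
    trans (canonical N≤x) (trans (cong (λ r → u (r + N * T)) x≡y) (sym (canonical N≤y)))
    where
    open ≡-Reasoning
    canonical : ∀ {x} → N ≤ x → u x ≡ u (x % T + N * T)
    canonical {x} N≤x = begin
      u x                               ≡⟨ periodic-+* N N≤x ⟨
      u (x + N * T)                     ≡⟨ cong (λ z → u (z + N * T)) (m≡m%n+[m/n]*n x T) ⟩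
      u (x % T + (x / T) * T + N * T)   ≡⟨ cong u (xy∙z≈xz∙y (x % T) _ _) ⟩
      u (x % T + N * T + (x / T) * T)   ≡⟨ periodic-+* (x / T) (≤-trans (m≤m*n N T) (m≤n+m _ _)) ⟩
      u (x % T + N * T)                 ∎

residue-collision : (s : ℕ → ℕ) (T : ℕ) .{{_ : NonZero T}} (N : ℕ) →
                    ∃₂ λ i j → N ≤ i × i < j × s i % T ≡ s j % T
residue-collision s T N with pigeonhole (n<1+n T) (λ k → fromℕ< (m%n<n (s (N + toℕ k)) T))
... | i , j , i<j , eq = N + toℕ i , N + toℕ j , m≤m+n N _ , +-monoʳ-< N i<j ,
                         fromℕ<-injective _ _ _ _ eq

-- Counting representations by their leading digit

reps : (b D L n : ℕ) → ℕ
reps b D L n = length (filter (λ v → value b v ≟ n) (digitVecs D L))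

headReps : (b D L e n : ℕ) → ℕ
headReps b D L e n = length (filter (λ v → value b v ≟ n) (map (e ∷_) (digitVecs D L)))

reps-suc : ∀ b D L n → reps b D (suc L) n ≡ sum (map (λ e → headReps b D L e n) (upTo D))
reps-suc b D L n =
  length-filter-concatMap (λ v → value b v ≟ n) (λ e → map (e ∷_) (digitVecs D L)) (upTo D)

headReps-match : ∀ {b} .{{_ : NonZero b}} D L {e m n} → e + b * m ≡ n →
                 headReps b D L e n ≡ reps b D L m
headReps-match {b} D L {e} {m} {n} e+bm≡n =
  trans (length-filter-map (λ v → value b v ≟ n) (e ∷_) (digitVecs D L))
        (cong length (filter-≐ _ _ (quotient , multiple) (digitVecs D L)))
  where
  quotient : ∀ {x} → e + b * x ≡ n → x ≡ m
  quotient {x} eq = *-cancelˡ-≡ x m b (+-cancelˡ-≡ e _ _ (trans eq (sym e+bm≡n)))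
  multiple : ∀ {x} → x ≡ m → e + b * x ≡ n
  multiple refl = e+bm≡n

headReps-none : ∀ b D L {e n} → (∀ x → e + b * x ≢ n) → headReps b D L e n ≡ 0
headReps-none b D L {e} {n} none =
  trans (length-filter-map (λ v → value b v ≟ n) (e ∷_) (digitVecs D L))
        (cong length (filter-none _ (All.universal (none ∘ value b) (digitVecs D L))))

head-digit? : ∀ b e n → (∃ λ m → e + b * m ≡ n) ⊎ (∀ x → e + b * x ≢ n)
head-digit? b e n with e ≤? n
... | no e≰n = inj₂ λ x eq → e≰n (subst (e ≤_) eq (m≤m+n e (b * x)))
... | yes e≤n with b ∣? (n ∸ e)
...   | yes (divides q n∸e≡qb) =
        inj₁ (q , trans (cong (e +_) (trans (*-comm b q) (sym n∸e≡qb))) (m+[n∸m]≡n e≤n))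
...   | no b∤n∸e = inj₂ λ x eq →
        b∤n∸e (divides x (trans (cong (_∸ e) (sym eq)) (trans (m+n∸m≡n e (b * x)) (*-comm b x))))

quotient-≤ : ∀ {b} .{{_ : NonZero b}} → 1 < b → ∀ e m {L} → e + b * m ≤ suc L → m ≤ L
quotient-≤ 1<b e zero    _  = z≤n
quotient-≤ {b} 1<b e (suc m) {L} le = s≤s⁻¹ (begin
  2 + m          ≤⟨ +-mono-≤ 1<b (m≤n*m m b) ⟩
  b + b * m      ≡⟨ *-suc b m ⟨
  b * suc m      ≤⟨ m≤n+m _ e ⟩
  e + b * suc m  ≤⟨ le ⟩
  suc L          ∎)
  where open ≤-Reasoning

reps-one-zero : ∀ b .{{_ : NonZero b}} D → reps b (suc D) 1 0 ≡ 1
reps-one-zero b D = begin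
  reps b (suc D) 1 0
    ≡⟨ reps-suc b (suc D) 0 0 ⟩
  headReps b (suc D) 0 0 0 + sum (map (λ e → headReps b (suc D) 0 e 0) (applyUpTo suc D))
    ≡⟨ cong₂ _+_ (headReps-match (suc D) 0 (*-zeroʳ b))
                 (sum-zero (map⁺ (applyUpTo⁺₂ suc D λ k → headReps-none b (suc D) 0 {suc k} {0} λ _ ()))) ⟩
  1 ∎
  where open ≡-Reasoning

-- Induct on L through the leading digit: since b ≥ 2 the remaining digits represent some m ≤ L - 1.
-- The base case needs the digit 0, hence the digit bound suc D.
reps-stable-suc : ∀ {b} .{{_ : NonZero b}} → 1 < b → ∀ D {L n} → n ≤ L →
                  reps b (suc D) (suc L) n ≡ reps b (suc D) L n
reps-stable-suc {b} 1<b D {zero} z≤n = reps-one-zero b D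
reps-stable-suc {b} 1<b D {suc L} {n} n≤1+L = begin
  reps b (suc D) (suc (suc L)) n                           ≡⟨ reps-suc b (suc D) (suc L) n ⟩
  sum (map (λ e → headReps b (suc D) (suc L) e n) digits) ≡⟨ cong sum (map-cong same-head digits) ⟩
  sum (map (λ e → headReps b (suc D) L e n) digits)       ≡⟨ reps-suc b (suc D) L n ⟨
  reps b (suc D) (suc L) n                                 ∎
  where
  open ≡-Reasoning
  digits : List ℕ
  digits = upTo (suc D)
  same-head : ∀ e → headReps b (suc D) (suc L) e n ≡ headReps b (suc D) L e n
  same-head e with head-digit? b e n
  ... | inj₁ (m , eq) = begin
    headReps b (suc D) (suc L) e n  ≡⟨ headReps-match (suc D) (suc L) eq ⟩
    reps b (suc D) (suc L) m        ≡⟨ reps-stable-suc 1<b D (quotient-≤ 1<b e m (subst (_≤ suc L) (sym eq) n≤1+L)) ⟩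
    reps b (suc D) L m              ≡⟨ headReps-match (suc D) L eq ⟨
    headReps b (suc D) L e n        ∎
  ... | inj₂ none = trans (headReps-none b (suc D) (suc L) none) (sym (headReps-none b (suc D) L none))

reps-stable : ∀ {b} .{{_ : NonZero b}} → 1 < b → ∀ D {L n} → n <′ L →
              reps b (suc D) L n ≡ numReps b (suc D) n
reps-stable 1<b D <′-base         = refl
reps-stable 1<b D (<′-step n<′L)  =
  trans (reps-stable-suc 1<b D (<⇒≤ (≤′⇒≤ n<′L))) (reps-stable 1<b D n<′L)

headReps-numReps : ∀ {b} .{{_ : NonZero b}} → 1 < b → ∀ D {e m n} → m < n → e + b * m ≡ n →
                   headReps b (suc D) n e n ≡ numReps b (suc D) m
headReps-numReps 1<b D {n = n} m<n eq = trans (headReps-match (suc D) n eq) (reps-stable 1<b D (≤⇒≤′ m<n))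

f-odd : ∀ m → f (1 + 2 * m) ≡ f m
f-odd m = begin
  f n                                                                ≡⟨ reps-suc 2 3 n n ⟩
  headReps 2 3 n 0 n + (headReps 2 3 n 1 n + (headReps 2 3 n 2 n + 0))
    ≡⟨ cong₂ _+_ (headReps-none 2 3 n (digit-mismatch 2 0 1 (λ ()) m))
        (cong₂ _+_ (headReps-numReps (s<s z<s) 2 (s≤s (m≤m+n m _)) refl)
                   (cong (_+ 0) (headReps-none 2 3 n (digit-mismatch 2 2 1 (λ ()) m)))) ⟩
  f m + 0                                                            ≡⟨ +-identityʳ (f m) ⟩
  f m                                                                ∎
  where
  open ≡-Reasoning
  n : ℕ
  n = 1 + 2 * m

f-even : ∀ m → f (2 + 2 * m) ≡ f (suc m) + f m
f-even m = begin
  f n                                                                ≡⟨ reps-suc 2 3 n n ⟩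
  headReps 2 3 n 0 n + (headReps 2 3 n 1 n + (headReps 2 3 n 2 n + 0))
    ≡⟨ cong₂ _+_ (headReps-numReps (s<s z<s) 2 (s≤s (s≤s (m≤m+n m _))) (*-suc 2 m))
        (cong (_+ (headReps 2 3 n 2 n + 0)) (headReps-none 2 3 n (digit-mismatch 2 1 2 (λ ()) m))) ⟩
  f (suc m) + (headReps 2 3 n 2 n + 0)
    ≡⟨ cong (f (suc m) +_) (trans (+-identityʳ _) (headReps-numReps (s<s z<s) 2 (m<n⇒m<1+n (s≤s (m≤m+n m _))) refl)) ⟩
  f (suc m) + f m                                                    ∎
  where
  open ≡-Reasoning
  n : ℕ
  n = 2 + 2 * m

module _ {b : ℕ} (1<b : 1 < b) where

  private
    0<b : 0 < b
    0<b = <-trans z<s 1<b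

    instance
      b≢0 : NonZero b
      b≢0 = >-nonZero 0<b

  g-zero : g b 0 ≡ 1
  g-zero = reps-one-zero b 1

  g-digit0 : ∀ m → g b (b * m) ≡ g b m
  g-digit0 zero    = cong (g b) (*-zeroʳ b)
  g-digit0 (suc m) = begin
    g b n                                     ≡⟨ reps-suc b 2 n n ⟩
    headReps b 2 n 0 n + (headReps b 2 n 1 n + 0)
      ≡⟨ cong₂ _+_ (headReps-numReps 1<b 1 (subst (suc m <_) (*-comm (suc m) b) (m<m*n (suc m) b 1<b)) refl)
                   (cong (_+ 0) (headReps-none b 2 n (digit-mismatch b 1 0 (distinct-digits b 1<b 0<b λ ()) (suc m)))) ⟩
    g b (suc m) + 0                           ≡⟨ +-identityʳ _ ⟩
    g b (suc m)                               ∎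
    where
    open ≡-Reasoning
    n : ℕ
    n = b * suc m

  g-digit1 : ∀ m → g b (1 + b * m) ≡ g b m
  g-digit1 m = begin
    g b n                                     ≡⟨ reps-suc b 2 n n ⟩
    headReps b 2 n 0 n + (headReps b 2 n 1 n + 0)
      ≡⟨ cong₂ _+_ (headReps-none b 2 n (digit-mismatch b 0 1 (distinct-digits b 0<b 1<b λ ()) m))
                   (cong (_+ 0) (headReps-numReps 1<b 1 (s≤s (m≤n*m m b)) refl)) ⟩
    g b m + 0                                 ≡⟨ +-identityʳ _ ⟩
    g b m                                     ∎
    where
    open ≡-Reasoning
    n : ℕ
    n = 1 + b * m

  g-digit2 : 2 < b → ∀ m → g b (2 + b * m) ≡ 0
  g-digit2 2<b m = trans (reps-suc b 2 n n)
    (cong₂ _+_ (headReps-none b 2 n (digit-mismatch b 0 2 (distinct-digits b 0<b 2<b λ ()) m))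
               (cong (_+ 0) (headReps-none b 2 n (digit-mismatch b 1 2 (distinct-digits b 1<b 2<b λ ()) m))))
    where
    n : ℕ
    n = 2 + b * m

  g-one : g b 1 ≡ 1
  g-one = trans (cong (λ x → g b (1 + x)) (sym (*-zeroʳ b))) (trans (g-digit1 0) g-zero)

  g-two : 2 < b → g b 2 ≡ 0
  g-two 2<b = trans (cong (λ x → g b (2 + x)) (sym (*-zeroʳ b))) (g-digit2 2<b 0)

  g-pow : ∀ k y → g b (b ^ k * y) ≡ g b y
  g-pow zero    y = cong (g b) (+-identityʳ y)
  g-pow (suc k) y = trans (cong (g b) (*-assoc b (b ^ k) y)) (trans (g-digit0 (b ^ k * y)) (g-pow k y))

  g-sum-powers : ∀ {i j} → i < j → g b (b ^ i + b ^ j) ≡ 1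
  g-sum-powers {i} i<j with m≤n⇒∃[o]m+o≡n i<j
  ... | k , refl = begin
    g b (b ^ i + b * b ^ (i + k))       ≡⟨ cong (λ x → g b (b ^ i + b * x)) (^-distribˡ-+-* b i k) ⟩
    g b (b ^ i + b * (b ^ i * b ^ k))   ≡⟨ cong (g b) (factor (b ^ i) (b ^ k) b) ⟩
    g b (b ^ i * (1 + b * b ^ k))       ≡⟨ g-pow i _ ⟩
    g b (1 + b * b ^ k)                 ≡⟨ g-digit1 (b ^ k) ⟩
    g b (b ^ k)                         ≡⟨ cong (g b) (*-identityʳ (b ^ k)) ⟨
    g b (b ^ k * 1)                     ≡⟨ g-pow k 1 ⟩
    g b 1                               ≡⟨ g-one ⟩
    1                                   ∎
    where
    open ≡-Reasoning
    factor : ∀ x y z → x + z * (x * y) ≡ x * (1 + z * y)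
    factor = solve-∀

  g-double-power : 2 < b → ∀ j → g b (b ^ j + b ^ j) ≡ 0
  g-double-power 2<b j = trans (cong (g b) (double (b ^ j))) (trans (g-pow j 2) (g-two 2<b))
    where
    double : ∀ x → x + x ≡ x * 2
    double = solve-∀

ones : ℕ → ℕ
ones zero    = 0
ones (suc k) = 1 + 2 * ones k

f-ones : ∀ k → f (ones k) ≡ 1
f-ones zero    = refl
f-ones (suc k) = trans (f-odd (ones k)) (f-ones k)

n≤1+2n : ∀ n → n ≤ 1 + 2 * n
n≤1+2n n = m≤n⇒m≤1+n (m≤m+n n _)

n≤ones : ∀ n → n ≤ ones n
n≤ones zero    = z≤n
n≤ones (suc n) = s≤s (≤-trans (n≤ones n) (m≤m+n (ones n) _))

data EvenOrOdd : ℕ → Set where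
  even : ∀ m → EvenOrOdd (2 * m)
  odd  : ∀ m → EvenOrOdd (1 + 2 * m)

evenOrOdd : ∀ n → EvenOrOdd n
evenOrOdd zero = even 0
evenOrOdd (suc n) with evenOrOdd n
... | even m = odd m
... | odd m  = subst EvenOrOdd (*-suc 2 m) (even (suc m))

-- Periods of f modulo d

module SternPeriods (d : ℕ) .{{_ : NonZero d}} (N : ℕ) where

  Period : ℕ → Set
  Period T = PeriodicFrom (λ n → f n % d) N T

  period-half : ∀ m → Period (2 * m) → Period m
  period-half m per n N≤n = begin
    f (n + m) % d                ≡⟨ cong (_% d) (f-odd (n + m)) ⟨
    f (1 + 2 * (n + m)) % d      ≡⟨ cong (λ x → f x % d) (regroup n m) ⟩
    f (1 + 2 * n + 2 * m) % d    ≡⟨ per (1 + 2 * n) (≤-trans N≤n (n≤1+2n n)) ⟩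
    f (1 + 2 * n) % d            ≡⟨ cong (_% d) (f-odd n) ⟩
    f n % d                      ∎
    where
    open ≡-Reasoning
    regroup : ∀ n m → 1 + 2 * (n + m) ≡ 1 + 2 * n + 2 * m
    regroup = solve-∀

  odd-period : ∀ {T} → 1 ≤ T → Period T → ∃ λ h → Period (1 + 2 * h)
  odd-period = go (<-wellFounded _)
    where
    go : ∀ {T} → Acc _<_ T → 1 ≤ T → Period T → ∃ λ h → Period (1 + 2 * h)
    go {T} (acc rs) 1≤T per with evenOrOdd T
    go (acc rs) 1≤T per | odd h  = h , per
    go (acc rs) ()  per | even zero
    go (acc rs) 1≤T per | even (suc m) =
      go (rs (m<m+n (suc m) z<s)) (s≤s z≤n) (period-half (suc m) per)

  module OddPeriod (h : ℕ) (per : Period (1 + 2 * h)) where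

    shift-odd : ∀ {k} → N ≤ k → f (suc (k + h)) % d ≡ (f (suc k) + f k) % d
    shift-odd {k} N≤k = begin
      f (suc (k + h)) % d               ≡⟨ cong (_% d) (f-odd (suc (k + h))) ⟨
      f (1 + 2 * suc (k + h)) % d       ≡⟨ cong (λ x → f x % d) (regroup k h) ⟩
      f (2 + 2 * k + (1 + 2 * h)) % d   ≡⟨ per (2 + 2 * k) (≤-trans N≤k (m≤n⇒m≤1+n (n≤1+2n k))) ⟩
      f (2 + 2 * k) % d                 ≡⟨ cong (_% d) (f-even k) ⟩
      (f (suc k) + f k) % d             ∎
      where
      open ≡-Reasoning
      regroup : ∀ k h → 1 + 2 * suc (k + h) ≡ 2 + 2 * k + (1 + 2 * h)
      regroup = solve-∀

    shift-even : ∀ {k} → N ≤ k → (f (suc (k + h)) + f (k + h)) % d ≡ f k % d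
    shift-even {k} N≤k = begin
      (f (suc (k + h)) + f (k + h)) % d  ≡⟨ cong (_% d) (f-even (k + h)) ⟨
      f (2 + 2 * (k + h)) % d            ≡⟨ cong (λ x → f x % d) (regroup k h) ⟩
      f (1 + 2 * k + (1 + 2 * h)) % d    ≡⟨ per (1 + 2 * k) (≤-trans N≤k (n≤1+2n k)) ⟩
      f (1 + 2 * k) % d                  ≡⟨ cong (_% d) (f-odd k) ⟩
      f k % d                            ∎
      where
      open ≡-Reasoning
      regroup : ∀ k h → 2 + 2 * (k + h) ≡ 1 + 2 * k + (1 + 2 * h)
      regroup = solve-∀

    antiperiodic : ∀ {n} → N ≤ n → (f n + f (2 + (n + h))) % d ≡ 0 % d
    antiperiodic {n} N≤n = %-+-cancelʳ (f (suc n)) d (begin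
      (f n + f (2 + (n + h)) + f (suc n)) % d    ≡⟨ cong (_% d) (xy∙z≈y∙zx (f n) (f (2 + (n + h))) (f (suc n))) ⟩
      (f (2 + (n + h)) + (f (suc n) + f n)) % d  ≡⟨ %-+-cong d {f (2 + (n + h))} refl (shift-odd N≤n) ⟨
      (f (2 + (n + h)) + f (suc (n + h))) % d    ≡⟨ shift-even (m≤n⇒m≤1+n N≤n) ⟩
      f (suc n) % d                              ∎)
      where open ≡-Reasoning

    period-three : Period 3
    period-three n N≤n = begin
      f (n + 3) % d                ≡⟨ per (n + 3) (≤-trans N≤n (m≤m+n n 3)) ⟨
      f (n + 3 + (1 + 2 * h)) % d  ≡⟨ cong (λ x → f x % d) (regroup n h) ⟩
      f (2 + (n′ + h)) % d         ≡⟨ %-+-cancelʳ (f n′) d cancelled ⟨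
      f n % d                      ∎
      where
      open ≡-Reasoning
      n′ : ℕ
      n′ = 2 + (n + h)
      regroup : ∀ n h → n + 3 + (1 + 2 * h) ≡ 2 + (2 + (n + h) + h)
      regroup = solve-∀
      cancelled : (f n + f n′) % d ≡ (f (2 + (n′ + h)) + f n′) % d
      cancelled = trans (antiperiodic N≤n)
        (sym (trans (cong (_% d) (+-comm (f (2 + (n′ + h))) (f n′)))
                    (antiperiodic {n′} (≤-trans N≤n (≤-trans (m≤m+n n h) (m≤n+m _ 2))))))

  period-one-vanishes : Period 1 → ∀ {k} → N ≤ k → f k % d ≡ 0 % d
  period-one-vanishes per {k} N≤k = %-+-cancelʳ (f (suc k)) d (begin
    (f k + f (suc k)) % d       ≡⟨ cong (_% d) (+-comm (f k) (f (suc k))) ⟩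
    (f (suc k) + f k) % d       ≡⟨ OddPeriod.shift-odd 0 per N≤k ⟨
    f (suc (k + 0)) % d         ≡⟨ cong (λ x → f (suc x) % d) (+-identityʳ k) ⟩
    f (suc k) % d               ∎)
    where open ≡-Reasoning

  no-period-one : 1 < d → ¬ Period 1
  no-period-one 1<d per =
    1%d≢0%d 1<d (trans (cong (_% d) (sym (f-ones N))) (period-one-vanishes per (n≤ones N)))

  period-three⇒d≡2 : 1 < d → Period 3 → d ≡ 2
  period-three⇒d≡2 1<d per = ≤-antisym (∣⇒≤ (m%n≡0⇒n∣m 2 d 2%d≡0)) 1<d
    where
    n : ℕ
    n = ones N
    2%d≡0 : 2 % d ≡ 0
    2%d≡0 = begin
      2 % d                        ≡⟨ cong (λ x → (x + x) % d) (f-ones N) ⟨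
      (f n + f n) % d              ≡⟨ %-+-cong d {f n} refl (per n (n≤ones N)) ⟨
      (f n + f (n + 3)) % d        ≡⟨ cong (λ x → (f n + f x) % d) (regroup n) ⟩
      (f n + f (2 + (n + 1))) % d  ≡⟨ OddPeriod.antiperiodic 1 per (n≤ones N) ⟩
      0 % d                        ≡⟨ m<n⇒m%n≡m (<-trans z<s 1<d) ⟩
      0                            ∎
      where
      open ≡-Reasoning
      regroup : ∀ n → n + 3 ≡ 2 + (n + 1)
      regroup = solve-∀

  period-three-minimal : 1 < d → ∀ T → 1 ≤ T → T ≤ 3 → Period T → T ≡ 3
  period-three-minimal 1<d 0 () _ _
  period-three-minimal 1<d 1 _ _ per = ⊥-elim (no-period-one 1<d per)
  period-three-minimal 1<d 2 _ _ per = ⊥-elim (no-period-one 1<d (period-half 1 per))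
  period-three-minimal 1<d 3 _ _ _   = refl
  period-three-minimal 1<d (suc (suc (suc (suc _)))) _ (s≤s (s≤s (s≤s ()))) _

n<b^n : ∀ {b} → 1 < b → ∀ n → n < b ^ n
n<b^n 1<b zero    = z<s
n<b^n {b} 1<b (suc n) = begin-strict
  suc n          ≤⟨ n<b^n 1<b n ⟩
  b ^ n          <⟨ m<m+n (b ^ n) (<-≤-trans z<s (n<b^n 1<b n)) ⟩
  b ^ n + b ^ n  ≡⟨ cong (b ^ n +_) (+-identityʳ (b ^ n)) ⟨
  2 * b ^ n      ≤⟨ *-monoˡ-≤ (b ^ n) 1<b ⟩
  b * b ^ n      ∎
  where open ≤-Reasoning

g-not-periodic : ∀ {b d} .{{_ : NonZero d}} → 2 < b → 1 < d → ∀ T .{{_ : NonZero T}} N →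
                 ¬ PeriodicFrom (λ n → g b n % d) N T
g-not-periodic {b} {d} 2<b 1<d T N per with residue-collision (b ^_) T N
... | i , j , N≤i , i<j , bⁱ≡bʲ = 1%d≢0%d 1<d (begin
  1 % d                      ≡⟨ cong (_% d) (g-sum-powers 1<b i<j) ⟨
  g b (b ^ i + b ^ j) % d    ≡⟨ periodic-%-cong per (N≤ (m≤n+m _ _)) (N≤ (m≤m+n _ _)) (%-+-cong T bⁱ≡bʲ refl) ⟩
  g b (b ^ j + b ^ j) % d    ≡⟨ cong (_% d) (g-double-power 1<b 2<b j) ⟩
  0 % d                      ∎)
  where
  open ≡-Reasoning
  1<b : 1 < b
  1<b = <-trans (s<s z<s) 2<b
  N≤ : ∀ {x} → b ^ j ≤ x → N ≤ x
  N≤ bʲ≤x = ≤-trans N≤i (≤-trans (<⇒≤ i<j) (≤-trans (<⇒≤ (n<b^n 1<b j)) bʲ≤x))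

g-not-eventually-periodic : ∀ b d .{{_ : NonZero d}} → 2 < b → 1 < d →
                            ¬ EventuallyPeriodic (λ n → g b n % d)
g-not-eventually-periodic b d 2<b 1<d (T , 1≤T , N , per) =
  g-not-periodic 2<b 1<d T {{>-nonZero 1≤T}} N per

f-eventual-period : ∀ d .{{_ : NonZero d}} → 1 < d → ∀ T → HasPeriod (λ n → f n % d) T →
                    d ≡ 2 × T ≡ 3
f-eventual-period d 1<d T ((1≤T , N , per) , minimal) =
  period-three⇒d≡2 1<d per₃ , period-three-minimal 1<d T 1≤T (minimal 3 (s≤s z≤n , N , per₃)) per
  where
  open SternPeriods d N
  per₃ : Period 3
  per₃ with h , per₂ₕ₊₁ ← odd-period 1≤T per = OddPeriod.period-three h per₂ₕ₊₁

theorem1p3 : ((d : ℕ) → .{{_ : NonZero d}} → 2 ≤ d → (T : ℕ)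
                → HasPeriod (λ n → f n % d) T → (d ≡ 2 × T ≡ 3))
           × ((b d : ℕ) → .{{_ : NonZero d}} → 3 ≤ b → 2 ≤ d
                → ¬ EventuallyPeriodic (λ n → g b n % d))
theorem1p3 = f-eventual-period , g-not-eventually-periodic
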